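{- Let $q$ be a prime power, $n\ge1$, $k\ge1$ integers, $c\in\mathbb F_q^*$, and $P=\sum_{i=0}^ma_i\theta^i\in\mathbb F_q[\theta]$. Let $\nu_c(P)(\theta)=P(c\theta)$ and let $W(c)$ be the $k\times k$ diagonal matrix whose $i$-th diagonal entry is $c^i$. Then $$\mathfrak M(\nu_c(P),c^{ -1}T,n,k)=c^{ -n}\,W(c)\,\mathfrak M(P,T,n,k)\,W(c)^{ -1},$$ where $\mathfrak M(F,c^{ -1}T,n,k)$ denotes $\mathfrak M(F,T,n,k)$ with $T$ replaced by $c^{ -1}T$.
   Context: For $F=\sum_{i=0}^mb_i\theta^i\in\mathbb F_q[\theta]$, $\mathfrak M(F,T,n,k)$ is the $k\times k$ matrix over $\mathbb F_q[T]$ with rows and columns indexed by $1,\dots,k$ and entries $\mathfrak M(F,T,n,k)_{i,j}=\sum_{l=0}^nT^{n-l}(-1)^l\binom nl b_{iq-j-l}$, where $b_s:=0$ for $s\notin\{0,\dots,m\}$. -}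

module Defs where

open import Level using (Level; _⊔_; suc)
open import Algebra.Bundles using (CommutativeRing; Semiring)
open import Data.Nat as ℕ using (ℕ; zero; _∸_; _≤?_; _≤_)
open import Data.Nat.Primality using (Prime)
open import Data.Nat.Combinatorics using (_C_)
open import Data.Fin using (Fin; toℕ)
open import Data.List using (List; []; _∷_)
open import Data.Product using (∃; ∃-syntax; _×_)
open import Relation.Nullary using (¬_; yes; no)
open import Relation.Binary.PropositionalEquality as ≡ using (_≡_)
open import Function.Bundles using (Inverse)

IsPrimePower : ℕ → Set
IsPrimePower q = ∃[ p ] ∃[ e ] (Prime p × 1 ≤ e × q ≡ p ℕ.^ e)

record FiniteField (c ℓ : Level) (q : ℕ) : Set (suc (c ⊔ ℓ)) where
  field
    cring : CommutativeRing c ℓ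
  open CommutativeRing cring public
  field
    0≉1     : ¬ (0# ≈ 1#)
    _⁻¹     : Carrier → Carrier
    inverse : ∀ x → ¬ (x ≈ 0#) → (x * (x ⁻¹)) ≈ 1#
    card    : Inverse setoid (≡.setoid (Fin q))

module Constructions {c ℓ : Level} {q : ℕ} (F : FiniteField c ℓ q) where
  open FiniteField F
  open import Algebra.Definitions.RawSemiring (Semiring.rawSemiring semiring) public using (_^_) renaming (_×_ to _·_)

  -- Polynomials in θ: coefficient list [a_0, ..., a_m]
  PolyΘ : Set c
  PolyΘ = List Carrier

  coeffΘ : PolyΘ → ℕ → Carrier
  coeffΘ []       _         = 0#
  coeffΘ (a ∷ as) zero      = a
  coeffΘ (a ∷ as) (ℕ.suc s) = coeffΘ as s

  -- ν_c(P)(θ) = P(cθ): the coefficient a_i becomes c^i a_i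
  νAux : Carrier → ℕ → PolyΘ → PolyΘ
  νAux x i []       = []
  νAux x i (a ∷ as) = ((x ^ i) * a) ∷ νAux x (ℕ.suc i) as

  ν : Carrier → PolyΘ → PolyΘ
  ν x P = νAux x 0 P

  -- b_{i q - j - l}, integer index; 0 if negative
  bIdx : PolyΘ → ℕ → ℕ → ℕ → Carrier
  bIdx P i j l with (j ℕ.+ l) ≤? (i ℕ.* q)
  ... | yes _ = coeffΘ P ((i ℕ.* q) ∸ (j ℕ.+ l))
  ... | no  _ = 0#

  -- Polynomials in T, as coefficient sequences (coefficient of T^d)
  PolyT : Set c
  PolyT = ℕ → Carrier

  _≈T_ : PolyT → PolyT → Set ℓ
  f ≈T g = ∀ d → f d ≈ g d

  0T : PolyT
  0T _ = 0#

  constT : Carrier → PolyT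
  constT a zero      = a
  constT a (ℕ.suc _) = 0#

  monoT : Carrier → ℕ → PolyT
  monoT a e d with e ℕ.≟ d
  ... | yes _ = a
  ... | no  _ = 0#

  _+T_ : PolyT → PolyT → PolyT
  (f +T g) d = f d + g d

  sumUpTo : ℕ → (ℕ → PolyT) → PolyT
  sumUpTo zero      g = g 0
  sumUpTo (ℕ.suc n) g = sumUpTo n g +T g (ℕ.suc n)

  sumC : ℕ → (ℕ → Carrier) → Carrier
  sumC zero      g = g 0
  sumC (ℕ.suc d) g = sumC d g + g (ℕ.suc d)

  _*T_ : PolyT → PolyT → PolyT
  (f *T g) d = sumC d (λ s → f s * g (d ∸ s))

  substT : Carrier → PolyT → PolyT
  substT a f d = (a ^ d) * f d

  -- k×k matrices over F_q[T], indexed by Fin k (row/col i ↔ toℕ i + 1)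
  Mat : ℕ → Set c
  Mat k = Fin k → Fin k → PolyT

  _≈M_ : ∀ {k} → Mat k → Mat k → Set ℓ
  A ≈M B = ∀ i j → A i j ≈T B i j

  sumFin : ∀ {k} → (Fin k → PolyT) → PolyT
  sumFin {zero}    g = 0T
  sumFin {ℕ.suc k} g = g Fin.zero +T sumFin (λ i → g (Fin.suc i))
    where import Data.Fin as Fin

  _*M_ : ∀ {k} → Mat k → Mat k → Mat k
  (A *M B) i j = sumFin (λ r → A i r *T B r j)

  scaleM : ∀ {k} → Carrier → Mat k → Mat k
  scaleM a A i j = constT a *T A i j

  substM : ∀ {k} → Carrier → Mat k → Mat k
  substM a A i j = substT a (A i j)

  idx : ∀ {k} → Fin k → ℕ
  idx i = ℕ.suc (toℕ i)

  W : ∀ {k} → Carrier → Mat k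
  W x i j with toℕ i ℕ.≟ toℕ j
  ... | yes _ = constT (x ^ idx i)
  ... | no  _ = 0T

  -- 𝔐(F,T,n,k)_{i,j} = Σ_{l=0}^n T^{n-l} (-1)^l binom(n,l) b_{iq-j-l}
  𝔐 : PolyΘ → ℕ → (k : ℕ) → Mat k
  𝔐 P n k i j = sumUpTo n (λ l →
    monoT (((- 1#) ^ l) * ((n C l) · bIdx P (idx i) (idx j) l)) (n ∸ l))

  idM : ∀ {k} → Mat k
  idM i j with toℕ i ℕ.≟ toℕ j
  ... | yes _ = constT 1#
  ... | no  _ = 0T

{-# OPTIONS --safe #-}
-- Substituting θ ↦ cθ multiplies b_s by c^s, and substituting T ↦ c⁻¹T multiplies the term
-- T^(n-l) by c^(l-n). The l-th term of entry (i, j) therefore gains the factor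
-- c^(l-n) c^(iq-j-l) = c^(-n) (c^q)^i c^(-j), and Fermat's little theorem c^q = c in F_q turns it
-- into the factor c^(-n) c^i c^(-j) of the conjugation by W(c).
-- For Fermat's theorem: x ↦ c x permutes F_q, so c^q ∏ unitPart x = ∏ unitPart (c x) · c, where
-- unitPart x = x for x ≠ 0 and unitPart 0 = 1 (the extra c comes from x = 0); ∏ unitPart x is invertible.
module Submission where

open import Defs
open import Level using (Level)
open import Data.Nat.Combinatorics using (_C_)
open import Data.Nat as ℕ using (ℕ; zero; suc; _≤_; _<_; _∸_; z≤n; s≤s; _≤?_; _≥_)
import Data.Nat.Properties as ℕₚ
open import Data.Fin using (Fin; zero; suc; toℕ)
open import Data.Fin.Properties using (_≟_; suc-injective; toℕ-injective; punchInᵢ≢i)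
open import Data.Fin.Permutation using (Permutation; permutation)
open import Data.Vec.Functional using (removeAt)
open import Data.List using ([]; _∷_)
open import Data.Product using (_×_; _,_; proj₁; proj₂)
open import Relation.Nullary using (¬_; Dec; yes; no)
open import Data.Empty using (⊥-elim)
open import Relation.Binary.PropositionalEquality as ≡ using (_≡_; _≢_)
open import Function using (_∘_)
open import Function.Bundles using (Inverse)
import Algebra.Properties.CommutativeMonoid.Sum as ProductProperties

module FermatLittle {cℓ ℓ : Level} {q : ℕ} (F : FiniteField cℓ ℓ q) where
  open FiniteField F hiding (zero)
  open Constructions F
  open import Relation.Binary.Reasoning.Setoid setoid
  private module Π = ProductProperties *-commutativeMonoid

  enum : Fin q → Carrier
  enum = Inverse.from card

  index : Carrier → Fin q
  index = Inverse.to card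

  index-enum : ∀ i → index (enum i) ≡ i
  index-enum i = Inverse.inverseˡ card refl

  enum-index : ∀ x → enum (index x) ≈ x
  enum-index x = Inverse.inverseʳ card ≡.refl

  index-injective : ∀ {x y} → index x ≡ index y → x ≈ y
  index-injective {x} {y} eq =
    trans (sym (enum-index x)) (trans (reflexive (≡.cong enum eq)) (enum-index y))

  _≟0 : ∀ x → Dec (x ≈ 0#)
  x ≟0 with index x ≟ index 0#
  ... | yes eq = yes (index-injective eq)
  ... | no neq = no (λ x≈0 → neq (Inverse.to-cong card x≈0))

  ∏ : (Carrier → Carrier) → Carrier
  ∏ f = Π.sum (λ i → f (enum i))

  ∏-cong : ∀ {f g} → (∀ x → f x ≈ g x) → ∏ f ≈ ∏ g
  ∏-cong f≈g = Π.sum-cong-≋ (λ i → f≈g (enum i))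

  ∏-distrib-* : ∀ f g → ∏ (λ x → f x * g x) ≈ ∏ f * ∏ g
  ∏-distrib-* f g = Π.∑-distrib-+ (λ i → f (enum i)) (λ i → g (enum i))

  ∏-const : ∀ c → ∏ (λ _ → c) ≈ c ^ q
  ∏-const c = Π.sum-replicate q

  product-ones : ∀ {m} (g : Fin m → Carrier) → (∀ i → g i ≈ 1#) → Π.sum g ≈ 1#
  product-ones {m} g g≈1 = trans (Π.sum-cong-≋ g≈1) (Π.sum-replicate-zero m)

  product-delta : ∀ {m v} (g : Fin m → Carrier) i → g i ≈ v → (∀ j → j ≢ i → g j ≈ 1#) → Π.sum g ≈ v
  product-delta {suc m} {v} g i gi≈v g≈1 = begin
    Π.sum g                    ≈⟨ Π.sum-remove {i = i} g ⟩
    g i * Π.sum (removeAt g i) ≈⟨ *-cong gi≈v (product-ones _ (λ j → g≈1 _ (punchInᵢ≢i i j))) ⟩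
    v * 1#                     ≈⟨ *-identityʳ v ⟩
    v                          ∎

  ∏-supported-at-0 : ∀ {f v} → (∀ x → x ≈ 0# → f x ≈ v) → (∀ x → ¬ x ≈ 0# → f x ≈ 1#) → ∏ f ≈ v
  ∏-supported-at-0 at0 off0 = product-delta _ (index 0#) (at0 _ (enum-index 0#))
    (λ j j≢0 → off0 _ (λ j≈0 → j≢0 (≡.trans (≡.sym (index-enum j)) (Inverse.to-cong card j≈0))))

  unitPart : Carrier → Carrier
  unitPart x with x ≟0
  ... | yes _ = 1#
  ... | no _  = x

  unitPart⁻¹ : Carrier → Carrier
  unitPart⁻¹ x with x ≟0
  ... | yes _ = 1#
  ... | no _  = x ⁻¹

  unitPart-cong : ∀ {x y} → x ≈ y → unitPart x ≈ unitPart y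
  unitPart-cong {x} {y} x≈y with x ≟0 | y ≟0
  ... | yes _   | yes _   = refl
  ... | yes x≈0 | no y≉0  = ⊥-elim (y≉0 (trans (sym x≈y) x≈0))
  ... | no x≉0  | yes y≈0 = ⊥-elim (x≉0 (trans x≈y y≈0))
  ... | no _    | no _    = x≈y

  unitPart-inverse : ∀ x → unitPart x * unitPart⁻¹ x ≈ 1#
  unitPart-inverse x with x ≟0
  ... | yes _   = *-identityˡ 1#
  ... | no x≉0  = inverse x x≉0

  scaledAt0 : Carrier → Carrier → Carrier
  scaledAt0 c x with x ≟0
  ... | yes _ = c
  ... | no _  = 1#

  module _ {c : Carrier} (c≉0 : ¬ c ≈ 0#) where
    private
      c⁻¹*c≈1 : c ⁻¹ * c ≈ 1#
      c⁻¹*c≈1 = trans (*-comm _ _) (inverse c c≉0)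

      cancel : ∀ {u v} x → u * v ≈ 1# → u * (v * x) ≈ x
      cancel x uv≈1 = trans (sym (*-assoc _ _ x)) (trans (*-congʳ uv≈1) (*-identityˡ x))

    multiplicationBy : Permutation q q
    multiplicationBy = permutation (λ i → index (c * enum i)) (λ i → index (c ⁻¹ * enum i))
      (λ i → ≡.trans (Inverse.to-cong card (trans (*-congˡ (enum-index _)) (cancel _ (inverse c c≉0)))) (index-enum i))
      (λ i → ≡.trans (Inverse.to-cong card (trans (*-congˡ (enum-index _)) (cancel _ c⁻¹*c≈1))) (index-enum i))

    ∏-reindex-* : ∀ f → (∀ {x y} → x ≈ y → f x ≈ f y) → ∏ (λ x → f (c * x)) ≈ ∏ f
    ∏-reindex-* f f-cong = sym (trans (Π.∑-permute (λ i → f (enum i)) multiplicationBy)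
                                     (Π.sum-cong-≋ (λ i → f-cong (enum-index (c * enum i)))))

    *-unitPart : ∀ x → c * unitPart x ≈ unitPart (c * x) * scaledAt0 c x
    *-unitPart x with x ≟0 | (c * x) ≟0
    ... | yes _   | yes _    = trans (*-identityʳ c) (sym (*-identityˡ c))
    ... | yes x≈0 | no cx≉0  = ⊥-elim (cx≉0 (trans (*-congˡ x≈0) (zeroʳ c)))
    ... | no x≉0  | yes cx≈0 = ⊥-elim (x≉0 (trans (sym (cancel x c⁻¹*c≈1)) (trans (*-congˡ cx≈0) (zeroʳ _))))
    ... | no _    | no _     = sym (*-identityʳ _)

    ∏-scaledAt0 : ∏ (scaledAt0 c) ≈ c
    ∏-scaledAt0 = ∏-supported-at-0 at0 off0
      where
      at0 : ∀ x → x ≈ 0# → scaledAt0 c x ≈ c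
      at0 x x≈0 with x ≟0
      ... | yes _  = refl
      ... | no x≉0 = ⊥-elim (x≉0 x≈0)
      off0 : ∀ x → ¬ x ≈ 0# → scaledAt0 c x ≈ 1#
      off0 x x≉0 with x ≟0
      ... | yes x≈0 = ⊥-elim (x≉0 x≈0)
      ... | no _    = refl

    ^-card : c ^ q ≈ c
    ^-card = begin
      c ^ q                        ≈⟨ sym (*-identityʳ _) ⟩
      c ^ q * 1#                   ≈⟨ *-congˡ (sym U*U⁻¹≈1) ⟩
      c ^ q * (U * ∏ unitPart⁻¹)   ≈⟨ sym (*-assoc _ _ _) ⟩
      (c ^ q * U) * ∏ unitPart⁻¹   ≈⟨ *-congʳ c^q*U≈c*U ⟩
      (c * U) * ∏ unitPart⁻¹       ≈⟨ *-assoc _ _ _ ⟩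
      c * (U * ∏ unitPart⁻¹)       ≈⟨ *-congˡ U*U⁻¹≈1 ⟩
      c * 1#                       ≈⟨ *-identityʳ c ⟩
      c                            ∎
      where
      U : Carrier
      U = ∏ unitPart

      U*U⁻¹≈1 : U * ∏ unitPart⁻¹ ≈ 1#
      U*U⁻¹≈1 = trans (sym (∏-distrib-* unitPart unitPart⁻¹)) (product-ones _ (λ i → unitPart-inverse (enum i)))

      c^q*U≈c*U : c ^ q * U ≈ c * U
      c^q*U≈c*U = begin
        c ^ q * U                                          ≈⟨ *-congʳ (sym (∏-const c)) ⟩
        ∏ (λ _ → c) * U                                    ≈⟨ sym (∏-distrib-* (λ _ → c) unitPart) ⟩
        ∏ (λ x → c * unitPart x)                           ≈⟨ ∏-cong *-unitPart ⟩
        ∏ (λ x → unitPart (c * x) * scaledAt0 c x)         ≈⟨ ∏-distrib-* (λ x → unitPart (c * x)) (scaledAt0 c) ⟩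
        ∏ (λ x → unitPart (c * x)) * ∏ (scaledAt0 c)       ≈⟨ *-cong (∏-reindex-* unitPart unitPart-cong) ∏-scaledAt0 ⟩
        U * c                                              ≈⟨ *-comm U c ⟩
        c * U                                              ∎

module PolynomialsInT {cℓ ℓ : Level} {q : ℕ} (F : FiniteField cℓ ℓ q) where
  open FiniteField F hiding (zero)
  open Constructions F
  open import Relation.Binary.Reasoning.Setoid setoid

  sumC-cong : ∀ d {f g : ℕ → Carrier} → (∀ s → f s ≈ g s) → sumC d f ≈ sumC d g
  sumC-cong zero    f≈g = f≈g 0
  sumC-cong (suc d) f≈g = +-cong (sumC-cong d f≈g) (f≈g (suc d))

  sumC-zero : ∀ d (f : ℕ → Carrier) → (∀ s → s ≤ d → f s ≈ 0#) → sumC d f ≈ 0#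
  sumC-zero zero    f f≈0 = f≈0 0 z≤n
  sumC-zero (suc d) f f≈0 =
    trans (+-cong (sumC-zero d f (λ s s≤d → f≈0 s (ℕₚ.m≤n⇒m≤1+n s≤d))) (f≈0 (suc d) ℕₚ.≤-refl)) (+-identityˡ 0#)

  sumC-first : ∀ d (f : ℕ → Carrier) → (∀ s → f (suc s) ≈ 0#) → sumC d f ≈ f 0
  sumC-first zero    f f≈0 = refl
  sumC-first (suc d) f f≈0 = trans (+-cong (sumC-first d f f≈0) (f≈0 d)) (+-identityʳ _)

  sumC-last : ∀ d (f : ℕ → Carrier) → (∀ s → s < d → f s ≈ 0#) → sumC d f ≈ f d
  sumC-last zero    f f≈0 = refl
  sumC-last (suc d) f f≈0 = trans (+-congʳ (sumC-zero d f (λ s s≤d → f≈0 s (s≤s s≤d)))) (+-identityˡ _)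

  constT-suc∸ : ∀ a d s → s < d → constT a (d ∸ s) ≈ 0#
  constT-suc∸ a d s s<d with d ∸ s in eq
  ... | zero  = ⊥-elim (ℕₚ.<⇒≱ s<d (ℕₚ.m∸n≡0⇒m≤n eq))
  ... | suc _ = refl

  *T-zeroˡ : ∀ {f} g → f ≈T 0T → (f *T g) ≈T 0T
  *T-zeroˡ g f≈0 d = sumC-zero d _ (λ s _ → trans (*-congʳ (f≈0 s)) (zeroˡ _))

  *T-zeroʳ : ∀ f {g} → g ≈T 0T → (f *T g) ≈T 0T
  *T-zeroʳ f g≈0 d = sumC-zero d _ (λ s _ → trans (*-congˡ (g≈0 (d ∸ s))) (zeroʳ _))

  *T-constˡ : ∀ {f a} g → f ≈T constT a → ∀ d → (f *T g) d ≈ a * g d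
  *T-constˡ g f≈a d = trans (sumC-cong d (λ s → *-congʳ (f≈a s)))
                            (sumC-first d _ (λ s → zeroˡ _))

  *T-constʳ : ∀ f {g a} → g ≈T constT a → ∀ d → (f *T g) d ≈ f d * a
  *T-constʳ f {g} {a} g≈a d = begin
    (f *T g) d                            ≈⟨ sumC-cong d (λ s → *-congˡ (g≈a (d ∸ s))) ⟩
    sumC d (λ s → f s * constT a (d ∸ s)) ≈⟨ sumC-last d _ (λ s s<d → trans (*-congˡ (constT-suc∸ a d s s<d)) (zeroʳ _)) ⟩
    f d * constT a (d ∸ d)                ≡⟨ ≡.cong (λ e → f d * constT a e) (ℕₚ.n∸n≡0 d) ⟩
    f d * a                               ∎

  sumUpTo-scale : ∀ n (f g : ℕ → PolyT) u v d → (∀ l → l ≤ n → u * f l d ≈ v * g l d) →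
                  u * sumUpTo n f d ≈ v * sumUpTo n g d
  sumUpTo-scale zero    f g u v d fg = fg 0 z≤n
  sumUpTo-scale (suc n) f g u v d fg = begin
    u * (sumUpTo n f d + f (suc n) d)       ≈⟨ distribˡ u _ _ ⟩
    u * sumUpTo n f d + u * f (suc n) d     ≈⟨ +-cong (sumUpTo-scale n f g u v d (λ l l≤n → fg l (ℕₚ.m≤n⇒m≤1+n l≤n)))
                                                      (fg (suc n) ℕₚ.≤-refl) ⟩
    v * sumUpTo n g d + v * g (suc n) d     ≈⟨ sym (distribˡ v _ _) ⟩
    v * (sumUpTo n g d + g (suc n) d)       ∎

  monoT-scale : ∀ u v a b e d → (e ≡ d → u * a ≈ v * b) → u * monoT a e d ≈ v * monoT b e d
  monoT-scale u v a b e d ab with e ℕ.≟ d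
  ... | yes e≡d = ab e≡d
  ... | no _    = trans (zeroʳ u) (sym (zeroʳ v))

  sumFin-zero : ∀ {k} (g : Fin k → PolyT) → (∀ r → g r ≈T 0T) → sumFin g ≈T 0T
  sumFin-zero {zero}  g g≈0 d = refl
  sumFin-zero {suc k} g g≈0 d =
    trans (+-cong (g≈0 zero d) (sumFin-zero (λ r → g (suc r)) (λ r → g≈0 (suc r)) d)) (+-identityˡ 0#)

  sumFin-delta : ∀ {k} (g : Fin k → PolyT) j → (∀ r → r ≢ j → g r ≈T 0T) → sumFin g ≈T g j
  sumFin-delta {suc k} g zero    g≈0 d =
    trans (+-congˡ (sumFin-zero (λ r → g (suc r)) (λ r → g≈0 (suc r) (λ ())) d)) (+-identityʳ _)
  sumFin-delta {suc k} g (suc j) g≈0 d =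
    trans (+-cong (g≈0 zero (λ ()) d) (sumFin-delta (λ r → g (suc r)) j (λ r r≢j → g≈0 (suc r) (r≢j ∘ suc-injective)) d))
          (+-identityˡ _)

module DiagonalMatrices {cℓ ℓ : Level} {q : ℕ} (F : FiniteField cℓ ℓ q) where
  open FiniteField F hiding (zero)
  open Constructions F
  open PolynomialsInT F
  open import Relation.Binary.Reasoning.Setoid setoid

  IsDiagonal : ∀ {k} → Mat k → (Fin k → Carrier) → Set ℓ
  IsDiagonal D x = (∀ i j → i ≢ j → D i j ≈T 0T) × (∀ i → D i i ≈T constT (x i))

  W-isDiagonal : ∀ {k} c → IsDiagonal {k} (W c) (λ i → c ^ idx i)
  W-isDiagonal c = off , on
    where
    off : ∀ i j → i ≢ j → W c i j ≈T 0T
    off i j i≢j d with toℕ i ℕ.≟ toℕ j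
    ... | yes i≡j = ⊥-elim (i≢j (toℕ-injective i≡j))
    ... | no _    = refl
    on : ∀ i → W c i i ≈T constT (c ^ idx i)
    on i d with toℕ i ℕ.≟ toℕ i
    ... | yes _   = refl
    ... | no i≢i  = ⊥-elim (i≢i ≡.refl)

  idM-isDiagonal : ∀ {k} → IsDiagonal {k} idM (λ _ → 1#)
  idM-isDiagonal = off , on
    where
    off : ∀ i j → i ≢ j → idM i j ≈T 0T
    off i j i≢j d with toℕ i ℕ.≟ toℕ j
    ... | yes i≡j = ⊥-elim (i≢j (toℕ-injective i≡j))
    ... | no _    = refl
    on : ∀ i → idM i i ≈T constT 1#
    on i d with toℕ i ℕ.≟ toℕ i
    ... | yes _   = refl
    ... | no i≢i  = ⊥-elim (i≢i ≡.refl)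

  diagonal-*M : ∀ {k} {D : Mat k} {x} → IsDiagonal D x → ∀ A i j d → (D *M A) i j d ≈ x i * A i j d
  diagonal-*M {D = D} {x} (off , on) A i j d = begin
    (D *M A) i j d     ≈⟨ sumFin-delta (λ r → D i r *T A r j) i (λ r r≢i → *T-zeroˡ (A r j) (off i r (r≢i ∘ ≡.sym))) d ⟩
    (D i i *T A i j) d ≈⟨ *T-constˡ (A i j) (on i) d ⟩
    x i * A i j d      ∎

  *M-diagonal : ∀ {k} {D : Mat k} {x} → IsDiagonal D x → ∀ A i j d → (A *M D) i j d ≈ A i j d * x j
  *M-diagonal {D = D} {x} (off , on) A i j d = begin
    (A *M D) i j d     ≈⟨ sumFin-delta (λ r → A i r *T D r j) j (λ r r≢j → *T-zeroʳ (A i r) (off r j r≢j)) d ⟩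
    (A i j *T D j j) d ≈⟨ *T-constʳ (A i j) (on j) d ⟩
    A i j d * x j      ∎

  rightInverse-isDiagonal : ∀ {k} {D E : Mat k} {x y} → IsDiagonal D x → (∀ i → y i * x i ≈ 1#) →
                            (D *M E) ≈M idM → IsDiagonal E y
  rightInverse-isDiagonal {D = D} {E} {x} {y} D-diag yx≈1 DE≈id = off , on
    where
    E≈y*id : ∀ i j d → E i j d ≈ y i * idM i j d
    E≈y*id i j d = begin
      E i j d               ≈⟨ sym (*-identityˡ _) ⟩
      1# * E i j d          ≈⟨ *-congʳ (sym (yx≈1 i)) ⟩
      (y i * x i) * E i j d ≈⟨ *-assoc _ _ _ ⟩
      y i * (x i * E i j d) ≈⟨ *-congˡ (trans (sym (diagonal-*M D-diag E i j d)) (DE≈id i j d)) ⟩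
      y i * idM i j d       ∎
    off : ∀ i j → i ≢ j → E i j ≈T 0T
    off i j i≢j d = trans (E≈y*id i j d) (trans (*-congˡ (proj₁ idM-isDiagonal i j i≢j d)) (zeroʳ _))
    on : ∀ i → E i i ≈T constT (y i)
    on i zero    = trans (E≈y*id i i zero) (trans (*-congˡ (proj₂ idM-isDiagonal i zero)) (*-identityʳ _))
    on i (suc d) = trans (E≈y*id i i (suc d)) (trans (*-congˡ (proj₂ idM-isDiagonal i (suc d))) (zeroʳ _))

module Rescaling {cℓ ℓ : Level} {q : ℕ} (F : FiniteField cℓ ℓ q) where
  open FiniteField F hiding (zero)
  open Constructions F
  open PolynomialsInT F
  open FermatLittle F using (^-card)
  open import Relation.Binary.Reasoning.Setoid setoid
  open import Algebra.Properties.Semiring.Exp semiring using (^-congˡ; ^-congʳ; ^-homo-*; ^-assocʳ)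
  open import Algebra.Properties.Semiring.Mult semiring using (×-congʳ; ×-comm-*)
  open import Algebra.Properties.CommutativeSemigroup *-commutativeSemigroup using (x∙yz≈y∙xz; xy∙z≈x∙zy; interchange)

  coeffΘ-νAux : ∀ x i P s → coeffΘ (νAux x i P) s ≈ x ^ (i ℕ.+ s) * coeffΘ P s
  coeffΘ-νAux x i []       s       = sym (zeroʳ _)
  coeffΘ-νAux x i (a ∷ P)  zero    = *-congʳ (^-congʳ x (≡.sym (ℕₚ.+-identityʳ i)))
  coeffΘ-νAux x i (a ∷ P)  (suc s) = trans (coeffΘ-νAux x (suc i) P s) (*-congʳ (^-congʳ x (≡.sym (ℕₚ.+-suc i s))))

  *-scaledTerm : ∀ u s N b → u * (s * (N · b)) ≈ s * (N · (u * b))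
  *-scaledTerm u s N b = trans (x∙yz≈y∙xz u s (N · b)) (*-congˡ (×-comm-* N u b))

  module _ {c : Carrier} (c≉0 : ¬ c ≈ 0#) where
    ^-inverse : ∀ m → (c ⁻¹) ^ m * c ^ m ≈ 1#
    ^-inverse zero    = *-identityˡ 1#
    ^-inverse (suc m) = begin
      (c ⁻¹ * (c ⁻¹) ^ m) * (c * c ^ m) ≈⟨ interchange _ _ _ _ ⟩
      (c ⁻¹ * c) * ((c ⁻¹) ^ m * c ^ m) ≈⟨ *-cong (trans (*-comm _ _) (inverse c c≉0)) (^-inverse m) ⟩
      1# * 1#                           ≈⟨ *-identityˡ 1# ⟩
      1#                                ∎

    ^-*-card : ∀ I → c ^ (I ℕ.* q) ≈ c ^ I
    ^-*-card I = begin
      c ^ (I ℕ.* q) ≡⟨ ≡.cong (c ^_) (ℕₚ.*-comm I q) ⟩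
      c ^ (q ℕ.* I) ≈⟨ sym (^-assocʳ c q I) ⟩
      (c ^ q) ^ I   ≈⟨ ^-congˡ I (^-card c≉0) ⟩
      c ^ I         ∎

    bIdx-ν : ∀ P I J l → c ^ (J ℕ.+ l) * bIdx (ν c P) I J l ≈ c ^ I * bIdx P I J l
    bIdx-ν P I J l with (J ℕ.+ l) ≤? (I ℕ.* q)
    ... | no _ = trans (zeroʳ _) (sym (zeroʳ _))
    ... | yes J+l≤Iq = begin
      c ^ (J ℕ.+ l) * coeffΘ (ν c P) E       ≈⟨ *-congˡ (coeffΘ-νAux c 0 P E) ⟩
      c ^ (J ℕ.+ l) * (c ^ E * coeffΘ P E)   ≈⟨ sym (*-assoc _ _ _) ⟩
      (c ^ (J ℕ.+ l) * c ^ E) * coeffΘ P E   ≈⟨ *-congʳ (sym (^-homo-* c (J ℕ.+ l) E)) ⟩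
      c ^ (J ℕ.+ l ℕ.+ E) * coeffΘ P E       ≡⟨ ≡.cong (λ e → c ^ e * coeffΘ P E) (ℕₚ.m+[n∸m]≡n J+l≤Iq) ⟩
      c ^ (I ℕ.* q) * coeffΘ P E             ≈⟨ *-congʳ (^-*-card I) ⟩
      c ^ I * coeffΘ P E                     ∎
      where
      E : ℕ
      E = I ℕ.* q ∸ (J ℕ.+ l)

    bIdx-ν-rescaled : ∀ P n I J l → l ≤ n →
      (c ⁻¹) ^ (n ∸ l) * bIdx (ν c P) I J l ≈ ((c ⁻¹) ^ n * (c ^ I * (c ⁻¹) ^ J)) * bIdx P I J l
    bIdx-ν-rescaled P n I J l l≤n = begin
      a ^ (n ∸ l) * b′                                     ≈⟨ *-congˡ (sym (trans (*-congʳ (^-inverse (J ℕ.+ l))) (*-identityˡ b′))) ⟩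
      a ^ (n ∸ l) * ((a ^ (J ℕ.+ l) * c ^ (J ℕ.+ l)) * b′) ≈⟨ *-congˡ (*-assoc _ _ _) ⟩
      a ^ (n ∸ l) * (a ^ (J ℕ.+ l) * (c ^ (J ℕ.+ l) * b′)) ≈⟨ *-congˡ (*-congˡ (bIdx-ν P I J l)) ⟩
      a ^ (n ∸ l) * (a ^ (J ℕ.+ l) * (c ^ I * b))          ≈⟨ sym (*-assoc _ _ _) ⟩
      (a ^ (n ∸ l) * a ^ (J ℕ.+ l)) * (c ^ I * b)          ≈⟨ *-congʳ (sym (^-homo-* a (n ∸ l) (J ℕ.+ l))) ⟩
      a ^ (n ∸ l ℕ.+ (J ℕ.+ l)) * (c ^ I * b)              ≡⟨ ≡.cong (λ e → a ^ e * (c ^ I * b)) exponent ⟩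
      a ^ (n ℕ.+ J) * (c ^ I * b)                          ≈⟨ *-congʳ (^-homo-* a n J) ⟩
      (a ^ n * a ^ J) * (c ^ I * b)                        ≈⟨ sym (*-assoc _ _ _) ⟩
      ((a ^ n * a ^ J) * c ^ I) * b                        ≈⟨ *-congʳ (xy∙z≈x∙zy _ _ _) ⟩
      (a ^ n * (c ^ I * a ^ J)) * b                        ∎
      where
      a b b′ : Carrier
      a  = c ⁻¹
      b  = bIdx P I J l
      b′ = bIdx (ν c P) I J l
      exponent : n ∸ l ℕ.+ (J ℕ.+ l) ≡ n ℕ.+ J
      exponent = ≡.trans (≡.cong (n ∸ l ℕ.+_) (ℕₚ.+-comm J l))
                 (≡.trans (≡.sym (ℕₚ.+-assoc (n ∸ l) l J)) (≡.cong (ℕ._+ J) (ℕₚ.m∸n+n≡m l≤n)))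

    𝔐-ν : ∀ P n k i j d →
      (c ⁻¹) ^ d * 𝔐 (ν c P) n k i j d ≈ ((c ⁻¹) ^ n * (c ^ idx i * (c ⁻¹) ^ idx j)) * 𝔐 P n k i j d
    𝔐-ν P n k i j d = sumUpTo-scale n (term (ν c P)) (term P) _ _ d termwise
      where
      K : Carrier
      K = (c ⁻¹) ^ n * (c ^ idx i * (c ⁻¹) ^ idx j)
      coefficient : PolyΘ → ℕ → Carrier
      coefficient Q l = (- 1#) ^ l * ((n C l) · bIdx Q (idx i) (idx j) l)
      term : PolyΘ → ℕ → PolyT
      term Q l = monoT (coefficient Q l) (n ∸ l)
      termwise : ∀ l → l ≤ n → (c ⁻¹) ^ d * term (ν c P) l d ≈ K * term P l d
      termwise l l≤n = monoT-scale _ _ _ _ (n ∸ l) d λ { ≡.refl → begin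
        (c ⁻¹) ^ (n ∸ l) * coefficient (ν c P) l
          ≈⟨ *-scaledTerm ((c ⁻¹) ^ (n ∸ l)) ((- 1#) ^ l) (n C l) _ ⟩
        (- 1#) ^ l * ((n C l) · ((c ⁻¹) ^ (n ∸ l) * bIdx (ν c P) (idx i) (idx j) l))
          ≈⟨ *-congˡ (×-congʳ (n C l) (bIdx-ν-rescaled P n (idx i) (idx j) l l≤n)) ⟩
        (- 1#) ^ l * ((n C l) · (K * bIdx P (idx i) (idx j) l))
          ≈⟨ sym (*-scaledTerm K ((- 1#) ^ l) (n C l) _) ⟩
        K * coefficient P l ∎ }

mainTheorem7 : {cℓ ℓ : Level} (q : ℕ) → IsPrimePower q → (F : FiniteField cℓ ℓ q) →
    let open FiniteField F
        open Constructions F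
    in
    (n k : ℕ) → n ≥ 1 → k ≥ 1 → (c : Carrier) → ¬ (c ≈ 0#) → (P : PolyΘ) →
    (Winv : Mat k) → (W c *M Winv) ≈M idM → (Winv *M W c) ≈M idM →
    substM (c ⁻¹) (𝔐 (ν c P) n k) ≈M scaleM ((c ⁻¹) ^ n) ((W c *M 𝔐 P n k) *M Winv)
mainTheorem7 q _ F n k _ _ c c≉0 P Winv W*Winv≈id _ i j d = begin
  (c ⁻¹) ^ d * 𝔐 (ν c P) n k i j d                         ≈⟨ 𝔐-ν c≉0 P n k i j d ⟩
  ((c ⁻¹) ^ n * (c ^ idx i * (c ⁻¹) ^ idx j)) * M i j d    ≈⟨ *-assoc _ _ _ ⟩
  (c ⁻¹) ^ n * ((c ^ idx i * (c ⁻¹) ^ idx j) * M i j d)    ≈⟨ *-congˡ (xy∙z≈xz∙y _ _ _) ⟩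
  (c ⁻¹) ^ n * ((c ^ idx i * M i j d) * (c ⁻¹) ^ idx j)    ≈⟨ *-congˡ (sym conjugation) ⟩
  (c ⁻¹) ^ n * ((W c *M M) *M Winv) i j d                  ≈⟨ sym (*T-constˡ (((W c *M M) *M Winv) i j) (λ _ → refl) d) ⟩
  scaleM ((c ⁻¹) ^ n) ((W c *M M) *M Winv) i j d           ∎
  where
  open FiniteField F hiding (zero)
  open Constructions F
  open PolynomialsInT F
  open DiagonalMatrices F
  open Rescaling F
  open import Relation.Binary.Reasoning.Setoid setoid
  open import Algebra.Properties.CommutativeSemigroup *-commutativeSemigroup using (xy∙z≈xz∙y)

  M : Mat k
  M = 𝔐 P n k

  -- W c *M Winv ≈M idM alone forces Winv to be diagonal.
  Winv-isDiagonal : IsDiagonal Winv (λ i → (c ⁻¹) ^ idx i)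
  Winv-isDiagonal = rightInverse-isDiagonal (W-isDiagonal c) (λ i → ^-inverse c≉0 (idx i)) W*Winv≈id

  conjugation : ((W c *M M) *M Winv) i j d ≈ (c ^ idx i * M i j d) * (c ⁻¹) ^ idx j
  conjugation = trans (*M-diagonal Winv-isDiagonal (W c *M M) i j d)
                      (*-congʳ (diagonal-*M (W-isDiagonal c) M i j d))
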